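{- Let $q$ be a prime power, $q-1=ls$ with $l,s$ positive integers, $r$ a positive integer with $r<q-1$, $\gamma$ a primitive element of $\mathbb{F}_q$, $\xi=\gamma^s$, $f\in\mathbb{F}_q[x]$, and $A_i=f(\xi^i)$ for $0\le i\le l-1$. If $P(x)=x^rf(x^s)$ is a permutation polynomial of $\mathbb{F}_q$, then: (i) $\gcd(r,s)=1$; (ii) $A_i\ne0$ for all $i=0,1,\dots,l-1$; (iii) $l\mid 2\,\mathrm{Ind}_\gamma(A_0A_1\cdots A_{l-1})$.
   Context: For $a\in\mathbb{F}_q^\ast$, $\mathrm{Ind}_\gamma(a)$ is the residue class $b\bmod(q-1)$ with $a=\gamma^b$; divisibility by $l$ is well defined since $l\mid q-1$. A permutation polynomial of $\mathbb{F}_q$ is one inducing a bijection of $\mathbb{F}_q$. -}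

module Defs where

open import Level using (0ℓ)
open import Data.Nat as ℕ using (ℕ; zero; suc)
open import Data.Nat.Primality using (Prime)
open import Data.Fin using (Fin)
open import Data.List using (List; []; _∷_)
open import Data.Product using (∃; _×_)
open import Relation.Nullary using (¬_)
open import Relation.Binary.PropositionalEquality as ≡ using (_≡_)
open import Algebra.Bundles using (CommutativeRing)
open import Function.Bundles using (Inverse)
open import Function.Definitions using (Bijective)

record FiniteField : Set₁ where
  field
    commRing : CommutativeRing 0ℓ 0ℓ
  open CommutativeRing commRing public
  field
    0≉1  : ¬ (0# ≈ 1#)
    inv  : ∀ x → ¬ (x ≈ 0#) → ∃ λ y → (x * y) ≈ 1#
    size : ℕ
    enum : Inverse (≡.setoid (Fin size)) setoid

module _ (F : FiniteField) where
  open FiniteField F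

  pow : Carrier → ℕ → Carrier
  pow x zero    = 1#
  pow x (suc n) = x * pow x n

  -- polynomials as coefficient lists, constant term first; evaluation (Horner)
  Poly : Set
  Poly = List Carrier

  eval : Poly → Carrier → Carrier
  eval []       x = 0#
  eval (c ∷ cs) x = c + (x * eval cs x)

  prodUpTo : ℕ → (ℕ → Carrier) → Carrier
  prodUpTo zero    g = 1#
  prodUpTo (suc n) g = prodUpTo n g * g n

  Primitive : Carrier → Set
  Primitive γ = ¬ (γ ≈ 0#) × (∀ x → ¬ (x ≈ 0#) → ∃ λ b → pow γ b ≈ x)

  IsPermutation : (Carrier → Carrier) → Set
  IsPermutation g = Bijective _≈_ _≈_ g

IsPrimePower : ℕ → Set
IsPrimePower q = ∃ λ p → ∃ λ k → Prime p × 1 ℕ.≤ k × q ≡ p ℕ.^ k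

-- P(x) = xʳ f(xˢ) fixes 0 (as r ≥ 1), so it permutes the units γ⁰, …, γ^(q-2).
-- (i) If d divides r and s and q - 1 = t d, then (γᵗ)ʳ = (γᵗ)ˢ = 1, so P(γᵗ) = P(1); hence γᵗ = 1, t = q - 1 and d = 1.
-- (ii) Aᵢ = 0 would give P(γⁱ) = 0 = P(0).
-- (iii) Let X = ∏_{i<q-1} γⁱ, a square root of 1, and Y = ∏_{i<l} Aᵢ. Since Aᵢ has period l, computing ∏_{i<q-1} P(γⁱ)
-- in two ways gives X = Xʳ Yˢ, hence (Y²)ˢ = 1; so if Y = γᵇ then l s = q - 1 divides 2 b s.
module Submission where

open import Defs
open import Data.Empty using (⊥-elim)
open import Data.Fin as Fin using (Fin; toℕ; fromℕ<)
open import Data.Fin.Permutation using (permutation)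
open import Data.Fin.Properties
  using (toℕ-fromℕ<; fromℕ<-injective; toℕ-injective; toℕ<n; pigeonhole; injective⇒≤; suc-injective)
open import Data.List using ([]; _∷_)
open import Data.Nat as ℕ using (ℕ; zero; suc; _∸_; _<_; _≤_; z≤n; s≤s; NonZero)
import Data.Nat.Properties as ℕ
open import Data.Nat.DivMod using (_%_; _/_; m≡m%n+[m/n]*n; m%n<n)
open import Data.Nat.Divisibility
  using (_∣_; divides; ∣-reflexive; ∣-trans; ∣-antisym; n∣m*n; quotient-∣; *-monoʳ-∣; *-cancelʳ-∣; m%n≡0⇒n∣m)
open import Data.Nat.GCD using (gcd; gcd[m,n]∣m; gcd[m,n]∣n)
open import Data.Nat.Tactic.RingSolver using (solve-∀)
open import Data.Product using (∃; _×_; _,_; proj₁; proj₂)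
open import Function.Bundles using (Inverse)
open import Function.Definitions using (Injective)
open import Relation.Binary.Definitions using (tri<; tri≈; tri>)
open import Relation.Binary.PropositionalEquality as ≡ using (_≡_)
open import Relation.Nullary using (¬_; Dec; yes; no)
open import Relation.Nullary.Decidable using (map′)
import Algebra.Properties.CommutativeMonoid.Sum as CommutativeMonoidSum

module FieldTheory (F : FiniteField) where
  open FiniteField F
  open import Algebra.Properties.CommutativeSemiring.Exp commutativeSemiring
    using (_^_; ^-homo-*; ^-assocʳ; ^-distrib-*)
  open import Algebra.Properties.CommutativeSemigroup *-commutativeSemigroup using (interchange)
  open import Relation.Binary.Reasoning.Setoid setoid
  open Inverse enum using (to; from; from-cong; strictlyInverseˡ; strictlyInverseʳ)
  module Π = CommutativeMonoidSum *-commutativeMonoid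

  pow≡^ : ∀ x n → pow F x n ≡ x ^ n
  pow≡^ x zero    = ≡.refl
  pow≡^ x (suc n) = ≡.cong (x *_) (pow≡^ x n)

  pow-cong : ∀ {x y} n → x ≈ y → pow F x n ≈ pow F y n
  pow-cong zero    _   = refl
  pow-cong (suc n) x≈y = *-cong x≈y (pow-cong n x≈y)

  pow-+ : ∀ x a b → pow F x (a ℕ.+ b) ≈ pow F x a * pow F x b
  pow-+ x a b rewrite pow≡^ x (a ℕ.+ b) | pow≡^ x a | pow≡^ x b = ^-homo-* x a b

  pow-* : ∀ x a b → pow F x (a ℕ.* b) ≈ pow F (pow F x a) b
  pow-* x a b rewrite pow≡^ x (a ℕ.* b) | pow≡^ x a | pow≡^ (x ^ a) b = sym (^-assocʳ x a b)

  pow-distrib-* : ∀ x y n → pow F (x * y) n ≈ pow F x n * pow F y n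
  pow-distrib-* x y n rewrite pow≡^ (x * y) n | pow≡^ x n | pow≡^ y n = ^-distrib-* x y n

  pow-comm : ∀ x a b → pow F (pow F x a) b ≈ pow F (pow F x b) a
  pow-comm x a b = begin
    pow F (pow F x a) b ≈⟨ pow-* x a b ⟨
    pow F x (a ℕ.* b)   ≡⟨ ≡.cong (pow F x) (ℕ.*-comm a b) ⟩
    pow F x (b ℕ.* a)   ≈⟨ pow-* x b a ⟩
    pow F (pow F x b) a ∎

  pow-1# : ∀ n → pow F 1# n ≈ 1#
  pow-1# zero    = refl
  pow-1# (suc n) = trans (*-identityˡ _) (pow-1# n)

  pow-multiple≈1 : ∀ x k c → pow F x k ≈ 1# → pow F x (k ℕ.* c) ≈ 1#
  pow-multiple≈1 x k c xᵏ≈1 = trans (pow-* x k c) (trans (pow-cong c xᵏ≈1) (pow-1# c))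

  pow-mod : ∀ x k .{{_ : NonZero k}} → pow F x k ≈ 1# → ∀ b → pow F x b ≈ pow F x (b % k)
  pow-mod x k xᵏ≈1 b = begin
    pow F x b                                     ≡⟨ ≡.cong (pow F x) (m≡m%n+[m/n]*n b k) ⟩
    pow F x (b % k ℕ.+ (b / k) ℕ.* k)             ≈⟨ pow-+ x (b % k) _ ⟩
    pow F x (b % k) * pow F x ((b / k) ℕ.* k)     ≡⟨ ≡.cong (λ e → pow F x (b % k) * pow F x e) (ℕ.*-comm (b / k) k) ⟩
    pow F x (b % k) * pow F x (k ℕ.* (b / k))     ≈⟨ *-congˡ (pow-multiple≈1 x k (b / k) xᵏ≈1) ⟩
    pow F x (b % k) * 1#                          ≈⟨ *-identityʳ _ ⟩
    pow F x (b % k)                               ∎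

  square-of-pow≈1 : ∀ {x y} r s → pow F x 2 ≈ 1# → x ≈ pow F x r * pow F y s → pow F (pow F y 2) s ≈ 1#
  square-of-pow≈1 {x} {y} r s x²≈1 x≈xʳyˢ = begin
    pow F (pow F y 2) s                               ≈⟨ *-identityˡ _ ⟨
    1# * pow F (pow F y 2) s                          ≈⟨ *-congʳ (trans (pow-cong r x²≈1) (pow-1# r)) ⟨
    pow F (pow F x 2) r * pow F (pow F y 2) s         ≈⟨ *-cong (pow-comm x 2 r) (pow-comm y 2 s) ⟩
    pow F (pow F x r) 2 * pow F (pow F y s) 2         ≈⟨ pow-distrib-* _ _ 2 ⟨
    pow F (pow F x r * pow F y s) 2                   ≈⟨ pow-cong 2 x≈xʳyˢ ⟨
    pow F x 2                                         ≈⟨ x²≈1 ⟩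
    1#                                                ∎

  eval-cong : ∀ f {x y} → x ≈ y → eval F f x ≈ eval F f y
  eval-cong []       _   = refl
  eval-cong (c ∷ cs) x≈y = +-congˡ (*-cong x≈y (eval-cong cs x≈y))

  0#-pow : ∀ k → 1 ≤ k → pow F 0# k ≈ 0#
  0#-pow (suc k) _ = zeroˡ (pow F 0# k)

  *-cancelˡ-≉0 : ∀ {x y z} → ¬ x ≈ 0# → x * y ≈ x * z → y ≈ z
  *-cancelˡ-≉0 {x} {y} {z} x≉0 xy≈xz with inv x x≉0
  ... | x⁻¹ , xx⁻¹≈1 = begin
    y              ≈⟨ *-identityˡ y ⟨
    1# * y         ≈⟨ *-congʳ (trans (sym xx⁻¹≈1) (*-comm x x⁻¹)) ⟩
    (x⁻¹ * x) * y  ≈⟨ *-assoc x⁻¹ x y ⟩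
    x⁻¹ * (x * y)  ≈⟨ *-congˡ xy≈xz ⟩
    x⁻¹ * (x * z)  ≈⟨ *-assoc x⁻¹ x z ⟨
    (x⁻¹ * x) * z  ≈⟨ *-congʳ (trans (*-comm x⁻¹ x) xx⁻¹≈1) ⟩
    1# * z         ≈⟨ *-identityˡ z ⟩
    z              ∎

  *-≉0 : ∀ {x y} → ¬ x ≈ 0# → ¬ y ≈ 0# → ¬ x * y ≈ 0#
  *-≉0 {x} x≉0 y≉0 xy≈0 = y≉0 (*-cancelˡ-≉0 x≉0 (trans xy≈0 (sym (zeroʳ x))))

  pow-≉0 : ∀ {x} n → ¬ x ≈ 0# → ¬ pow F x n ≈ 0#
  pow-≉0 zero    _   1≈0 = 0≉1 (sym 1≈0)
  pow-≉0 (suc n) x≉0     = *-≉0 x≉0 (pow-≉0 n x≉0)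

  pow-cancel : ∀ {x a b} → ¬ x ≈ 0# → a ≤ b → pow F x a ≈ pow F x b → pow F x (b ∸ a) ≈ 1#
  pow-cancel {x} {a} {b} x≉0 a≤b xᵃ≈xᵇ = sym (*-cancelˡ-≉0 (pow-≉0 a x≉0) (begin
    pow F x a * 1#               ≈⟨ *-identityʳ _ ⟩
    pow F x a                    ≈⟨ xᵃ≈xᵇ ⟩
    pow F x b                    ≡⟨ ≡.cong (pow F x) (ℕ.m+[n∸m]≡n a≤b) ⟨
    pow F x (a ℕ.+ (b ∸ a))      ≈⟨ pow-+ x a (b ∸ a) ⟩
    pow F x a * pow F x (b ∸ a)  ∎))

  from-injective : ∀ {x y} → from x ≡ from y → x ≈ y
  from-injective {x} {y} eq = trans (sym (strictlyInverseˡ x)) (trans (reflexive (≡.cong to eq)) (strictlyInverseˡ y))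

  _≈?_ : ∀ x y → Dec (x ≈ y)
  x ≈? y = map′ from-injective from-cong (from x Fin.≟ from y)

  size≤ : ∀ {n} (c : Carrier → Fin n) → (∀ {x y} → c x ≡ c y → x ≈ y) → size ≤ n
  size≤ c c-injective = injective⇒≤ (λ {i} {j} eq →
    ≡.trans (≡.sym (strictlyInverseʳ i)) (≡.trans (from-cong (c-injective eq)) (strictlyInverseʳ j)))

  2≤size : 2 ≤ size
  2≤size = injective⇒≤ {f = λ i → from (zero-or-one i)} (λ eq → zero-or-one-injective _ _ (from-injective eq))
    where
    zero-or-one : Fin 2 → Carrier
    zero-or-one Fin.zero    = 0#
    zero-or-one (Fin.suc _) = 1#

    zero-or-one-injective : ∀ i j → zero-or-one i ≈ zero-or-one j → i ≡ j
    zero-or-one-injective Fin.zero           Fin.zero           _   = ≡.refl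
    zero-or-one-injective Fin.zero           (Fin.suc Fin.zero) 0≈1 = ⊥-elim (0≉1 0≈1)
    zero-or-one-injective (Fin.suc Fin.zero) Fin.zero           1≈0 = ⊥-elim (0≉1 (sym 1≈0))
    zero-or-one-injective (Fin.suc Fin.zero) (Fin.suc Fin.zero) _   = ≡.refl

  q-1 : ℕ
  q-1 = size ∸ 1

  1≤q-1 : 1 ≤ q-1
  1≤q-1 = ℕ.∸-monoˡ-≤ 1 2≤size

  size≡1+q-1 : size ≡ suc q-1
  size≡1+q-1 = ≡.sym (ℕ.m+[n∸m]≡n (ℕ.≤-trans (s≤s z≤n) 2≤size))

  instance
    q-1-nonZero : NonZero q-1
    q-1-nonZero = ℕ.>-nonZero 1≤q-1

  prod-cong : ∀ n {g h : ℕ → Carrier} → (∀ i → g i ≈ h i) → prodUpTo F n g ≈ prodUpTo F n h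
  prod-cong zero    _   = refl
  prod-cong (suc n) g≈h = *-cong (prod-cong n g≈h) (g≈h n)

  prod-distrib-* : ∀ n g h → prodUpTo F n (λ i → g i * h i) ≈ prodUpTo F n g * prodUpTo F n h
  prod-distrib-* zero    g h = sym (*-identityˡ 1#)
  prod-distrib-* (suc n) g h = trans (*-congʳ (prod-distrib-* n g h)) (interchange _ _ _ _)

  prod-pow : ∀ n g k → prodUpTo F n (λ i → pow F (g i) k) ≈ pow F (prodUpTo F n g) k
  prod-pow zero    g k = sym (pow-1# k)
  prod-pow (suc n) g k = trans (*-congʳ (prod-pow n g k)) (sym (pow-distrib-* _ _ k))

  prod-+ : ∀ a b g → prodUpTo F (a ℕ.+ b) g ≈ prodUpTo F a g * prodUpTo F b (λ i → g (a ℕ.+ i))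
  prod-+ a zero g rewrite ℕ.+-identityʳ a = sym (*-identityʳ _)
  prod-+ a (suc b) g = begin
    prodUpTo F (a ℕ.+ suc b) g                                        ≡⟨ ≡.cong (λ n → prodUpTo F n g) (ℕ.+-suc a b) ⟩
    prodUpTo F (a ℕ.+ b) g * g (a ℕ.+ b)                              ≈⟨ *-congʳ (prod-+ a b g) ⟩
    (prodUpTo F a g * prodUpTo F b (λ i → g (a ℕ.+ i))) * g (a ℕ.+ b) ≈⟨ *-assoc _ _ _ ⟩
    prodUpTo F a g * prodUpTo F (suc b) (λ i → g (a ℕ.+ i))           ∎

  prod-periodic : ∀ l g → (∀ i → g (l ℕ.+ i) ≈ g i) → ∀ k → prodUpTo F (l ℕ.* k) g ≈ pow F (prodUpTo F l g) k
  prod-periodic l g _ zero rewrite ℕ.*-zeroʳ l = refl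
  prod-periodic l g g-periodic (suc k) = begin
    prodUpTo F (l ℕ.* suc k) g                              ≡⟨ ≡.cong (λ n → prodUpTo F n g) (ℕ.*-suc l k) ⟩
    prodUpTo F (l ℕ.+ l ℕ.* k) g                            ≈⟨ prod-+ l (l ℕ.* k) g ⟩
    prodUpTo F l g * prodUpTo F (l ℕ.* k) (λ i → g (l ℕ.+ i)) ≈⟨ *-congˡ (prod-cong (l ℕ.* k) g-periodic) ⟩
    prodUpTo F l g * prodUpTo F (l ℕ.* k) g                 ≈⟨ *-congˡ (prod-periodic l g g-periodic k) ⟩
    prodUpTo F l g * pow F (prodUpTo F l g) k               ∎

  prod≈∏ : ∀ n g → prodUpTo F n g ≈ Π.sum (λ (i : Fin n) → g (toℕ i))
  prod≈∏ zero    g = refl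
  prod≈∏ (suc n) g = begin
    prodUpTo F (suc n) g                        ≈⟨ prod-+ 1 n g ⟩
    (1# * g 0) * prodUpTo F n (λ i → g (suc i)) ≈⟨ *-cong (*-identityˡ (g 0)) (prod≈∏ n (λ i → g (suc i))) ⟩
    Π.sum (λ (i : Fin (suc n)) → g (toℕ i))     ∎

  prod-powers-squared : ∀ x n → prodUpTo F n (pow F x) * prodUpTo F n (pow F x) ≈ pow F x (n ℕ.* (n ∸ 1))
  prod-powers-squared x zero    = *-identityˡ 1#
  prod-powers-squared x (suc n) = begin
    (Sₙ * pow F x n) * (Sₙ * pow F x n)          ≈⟨ interchange _ _ _ _ ⟩
    (Sₙ * Sₙ) * (pow F x n * pow F x n)          ≈⟨ *-cong (prod-powers-squared x n) (sym (pow-+ x n n)) ⟩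
    pow F x (n ℕ.* (n ∸ 1)) * pow F x (n ℕ.+ n)  ≈⟨ pow-+ x (n ℕ.* (n ∸ 1)) (n ℕ.+ n) ⟨
    pow F x (n ℕ.* (n ∸ 1) ℕ.+ (n ℕ.+ n))        ≡⟨ ≡.cong (pow F x) (exponent-step n) ⟩
    pow F x (suc n ℕ.* n)                        ∎
    where
    Sₙ = prodUpTo F n (pow F x)

    exponent-step : ∀ n → n ℕ.* (n ∸ 1) ℕ.+ (n ℕ.+ n) ≡ suc n ℕ.* n
    exponent-step zero    = ≡.refl
    exponent-step (suc n) = shifted n
      where
      shifted : ∀ n → suc n ℕ.* n ℕ.+ (suc n ℕ.+ suc n) ≡ suc (suc n) ℕ.* suc n
      shifted = solve-∀

  module Cyclic {γ} (γ-primitive : Primitive F γ) where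
    γ≉0 : ¬ γ ≈ 0#
    γ≉0 = proj₁ γ-primitive

    exponent : ∀ x → ¬ x ≈ 0# → ℕ
    exponent x x≉0 = proj₁ (proj₂ γ-primitive x x≉0)

    pow-exponent : ∀ x x≉0 → pow F γ (exponent x x≉0) ≈ x
    pow-exponent x x≉0 = proj₂ (proj₂ γ-primitive x x≉0)

    -- If γᵏ ≈ 1, sending 0 to 0 and x ≉ 0 to 1 + (exponent of x mod k) embeds the field into Fin (1 + k).
    order-minimal : ∀ k → 1 ≤ k → pow F γ k ≈ 1# → q-1 ≤ k
    order-minimal k@(suc _) _ γᵏ≈1 =
      ℕ.s≤s⁻¹ (≡.subst (_≤ suc k) size≡1+q-1 (size≤ (λ x → code x (x ≈? 0#)) (code-injective _ _)))
      where
      code : ∀ x → Dec (x ≈ 0#) → Fin (suc k)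
      code x (yes _)   = Fin.zero
      code x (no  x≉0) = Fin.suc (fromℕ< (m%n<n (exponent x x≉0) k))

      code-injective : ∀ {x y} dx dy → code x dx ≡ code y dy → x ≈ y
      code-injective (yes x≈0) (yes y≈0) _ = trans x≈0 (sym y≈0)
      code-injective (yes _)   (no  _)   ()
      code-injective (no  _)   (yes _)   ()
      code-injective {x} {y} (no x≉0) (no y≉0) eq = begin
        x                            ≈⟨ pow-exponent x x≉0 ⟨
        pow F γ (exponent x x≉0)     ≈⟨ pow-mod γ k γᵏ≈1 (exponent x x≉0) ⟩
        pow F γ (exponent x x≉0 % k) ≡⟨ ≡.cong (pow F γ) (fromℕ<-injective _ _ _ _ (suc-injective eq)) ⟩
        pow F γ (exponent y y≉0 % k) ≈⟨ pow-mod γ k γᵏ≈1 (exponent y y≉0) ⟨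
        pow F γ (exponent y y≉0)     ≈⟨ pow-exponent y y≉0 ⟩
        y                            ∎

    -- The pigeonhole principle applied to 0, γ⁰, γ¹, …, γ^(q-1).
    pow-≈1-below-size : ∃ λ k → 1 ≤ k × k ≤ q-1 × pow F γ k ≈ 1#
    pow-≈1-below-size with pigeonhole (ℕ.n<1+n size) (λ i → from (zero-and-powers i))
      where
      zero-and-powers : Fin (suc size) → Carrier
      zero-and-powers Fin.zero    = 0#
      zero-and-powers (Fin.suc i) = pow F γ (toℕ i)
    ... | Fin.zero  , Fin.suc j , _   , eq = ⊥-elim (pow-≉0 (toℕ j) γ≉0 (sym (from-injective eq)))
    ... | Fin.suc i , Fin.suc j , i<j , eq =
      toℕ j ∸ toℕ i , ℕ.m<n⇒0<n∸m (ℕ.s<s⁻¹ i<j) , ℕ.≤-trans (ℕ.m∸n≤m (toℕ j) (toℕ i)) j≤q-1 ,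
      pow-cancel γ≉0 (ℕ.<⇒≤ (ℕ.s<s⁻¹ i<j)) (from-injective eq)
      where
      j≤q-1 : toℕ j ≤ q-1
      j≤q-1 = ℕ.s≤s⁻¹ (≡.subst (toℕ j <_) size≡1+q-1 (toℕ<n j))

    pow-order : pow F γ q-1 ≈ 1#
    pow-order with pow-≈1-below-size
    ... | k , 1≤k , k≤q-1 , γᵏ≈1 =
      ≡.subst (λ e → pow F γ e ≈ 1#) (ℕ.≤-antisym k≤q-1 (order-minimal k 1≤k γᵏ≈1)) γᵏ≈1

    prod-units-squared : pow F (prodUpTo F q-1 (pow F γ)) 2 ≈ 1#
    prod-units-squared = begin
      X * (X * 1#)                ≈⟨ *-congˡ (*-identityʳ X) ⟩
      X * X                       ≈⟨ prod-powers-squared γ q-1 ⟩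
      pow F γ (q-1 ℕ.* (q-1 ∸ 1)) ≈⟨ pow-multiple≈1 γ q-1 (q-1 ∸ 1) pow-order ⟩
      1#                          ∎
      where
      X = prodUpTo F q-1 (pow F γ)

    pow≈1⇒∣ : ∀ k → pow F γ k ≈ 1# → q-1 ∣ k
    pow≈1⇒∣ k γᵏ≈1 with k % q-1 in k%q-1≡e
    ... | zero  = m%n≡0⇒n∣m k q-1 k%q-1≡e
    ... | suc e =
      ⊥-elim (ℕ.<⇒≱ (≡.subst (_< q-1) k%q-1≡e (m%n<n k q-1)) (order-minimal (suc e) (s≤s z≤n) γ¹⁺ᵉ≈1))
      where
      γ¹⁺ᵉ≈1 : pow F γ (suc e) ≈ 1#
      γ¹⁺ᵉ≈1 = ≡.subst (λ e → pow F γ e ≈ 1#) k%q-1≡e (trans (sym (pow-mod γ q-1 pow-order k)) γᵏ≈1)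

    ∣⇒pow≈1 : ∀ k → q-1 ∣ k → pow F γ k ≈ 1#
    ∣⇒pow≈1 k (divides c k≡c*q-1) rewrite k≡c*q-1 | ℕ.*-comm c q-1 = pow-multiple≈1 γ q-1 c pow-order

    pow-≉-below-order : ∀ {a b} → a < b → b < q-1 → ¬ pow F γ a ≈ pow F γ b
    pow-≉-below-order {a} {b} a<b b<q-1 γᵃ≈γᵇ = ℕ.<⇒≱ b<q-1 (ℕ.≤-trans q-1≤b-a (ℕ.m∸n≤m b a))
      where
      q-1≤b-a : q-1 ≤ b ∸ a
      q-1≤b-a = order-minimal (b ∸ a) (ℕ.m<n⇒0<n∸m a<b) (pow-cancel γ≉0 (ℕ.<⇒≤ a<b) γᵃ≈γᵇ)

    pow-injective : ∀ {a b} → a < q-1 → b < q-1 → pow F γ a ≈ pow F γ b → a ≡ b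
    pow-injective {a} {b} a<q-1 b<q-1 γᵃ≈γᵇ with ℕ.<-cmp a b
    ... | tri< a<b _ _ = ⊥-elim (pow-≉-below-order a<b b<q-1 γᵃ≈γᵇ)
    ... | tri≈ _ a≡b _ = a≡b
    ... | tri> _ _ b<a = ⊥-elim (pow-≉-below-order b<a a<q-1 (sym γᵃ≈γᵇ))

    log : ∀ x → ¬ x ≈ 0# → Fin q-1
    log x x≉0 = fromℕ< (m%n<n (exponent x x≉0) q-1)

    pow-log : ∀ x x≉0 → pow F γ (toℕ (log x x≉0)) ≈ x
    pow-log x x≉0 = begin
      pow F γ (toℕ (log x x≉0))      ≡⟨ ≡.cong (pow F γ) (toℕ-fromℕ< (m%n<n (exponent x x≉0) q-1)) ⟩
      pow F γ (exponent x x≉0 % q-1) ≈⟨ pow-mod γ q-1 pow-order (exponent x x≉0) ⟨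
      pow F γ (exponent x x≉0)       ≈⟨ pow-exponent x x≉0 ⟩
      x                              ∎

    log-unique : ∀ x x≉0 (j : Fin q-1) → pow F γ (toℕ j) ≈ x → log x x≉0 ≡ j
    log-unique x x≉0 j γʲ≈x = toℕ-injective (pow-injective (toℕ<n _) (toℕ<n j) (trans (pow-log x x≉0) (sym γʲ≈x)))

    -- `log` turns P into a permutation of the exponents Fin q-1.
    prod-permute-units : ∀ {P} → IsPermutation F P → P 0# ≈ 0# →
                         prodUpTo F q-1 (λ i → P (pow F γ i)) ≈ prodUpTo F q-1 (pow F γ)
    prod-permute-units {P} (P-injective , P-surjective) P0≈0 = begin
      prodUpTo F q-1 (λ i → P (pow F γ i))  ≈⟨ prod≈∏ q-1 (λ i → P (pow F γ i)) ⟩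
      Π.sum (λ (i : Fin q-1) → P (pow F γ (toℕ i)))
        ≈⟨ Π.sum-cong-≋ {q-1} (λ i → sym (pow-log _ (P-image-≉0 (toℕ i)))) ⟩
      Π.sum (λ (i : Fin q-1) → pow F γ (toℕ (σ i)))
        ≈⟨ Π.sum-permute (λ i → pow F γ (toℕ i)) (permutation σ τ σ∘τ≗id τ∘σ≗id) ⟨
      Π.sum (λ (i : Fin q-1) → pow F γ (toℕ i)) ≈⟨ prod≈∏ q-1 (pow F γ) ⟨
      prodUpTo F q-1 (pow F γ)              ∎
      where
      P-image-≉0 : ∀ i → ¬ P (pow F γ i) ≈ 0#
      P-image-≉0 i Pγⁱ≈0 = pow-≉0 i γ≉0 (P-injective (trans Pγⁱ≈0 (sym P0≈0)))

      σ : Fin q-1 → Fin q-1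
      σ i = log (P (pow F γ (toℕ i))) (P-image-≉0 (toℕ i))

      preimage : Fin q-1 → Carrier
      preimage j = proj₁ (P-surjective (pow F γ (toℕ j)))

      P-preimage : ∀ j {z} → z ≈ preimage j → P z ≈ pow F γ (toℕ j)
      P-preimage j = proj₂ (P-surjective (pow F γ (toℕ j)))

      preimage-≉0 : ∀ j → ¬ preimage j ≈ 0#
      preimage-≉0 j preimage≈0 = pow-≉0 (toℕ j) γ≉0 (trans (sym (P-preimage j (sym preimage≈0))) P0≈0)

      τ : Fin q-1 → Fin q-1
      τ j = log (preimage j) (preimage-≉0 j)

      σ∘τ≗id : ∀ j → σ (τ j) ≡ j
      σ∘τ≗id j = log-unique _ _ j (sym (P-preimage j (pow-log (preimage j) (preimage-≉0 j))))

      τ∘σ≗id : ∀ i → τ (σ i) ≡ i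
      τ∘σ≗id i = log-unique _ _ i (sym (P-injective (trans (P-preimage (σ i) refl) (pow-log _ (P-image-≉0 (toℕ i))))))

  module PermutationPolynomial (r s : ℕ) (f : Poly F) where
    P : Carrier → Carrier
    P x = pow F x r * eval F f (pow F x s)

    P-0# : 1 ≤ r → P 0# ≈ 0#
    P-0# 1≤r = trans (*-congʳ (0#-pow r 1≤r)) (zeroˡ _)

    P-root-of-unity : ∀ {x} → pow F x r ≈ 1# → pow F x s ≈ 1# → P x ≈ P 1#
    P-root-of-unity xʳ≈1 xˢ≈1 = trans (*-cong xʳ≈1 (eval-cong f xˢ≈1)) (sym (*-cong (pow-1# r) (eval-cong f (pow-1# s))))

    P-pow : ∀ x i → P (pow F x i) ≈ pow F (pow F x i) r * eval F f (pow F (pow F x s) i)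
    P-pow x i = *-congˡ (eval-cong f (pow-comm x i s))

    module _ {γ} (γ-primitive : Primitive F γ) where
      open Cyclic γ-primitive

      A : ℕ → Carrier
      A i = eval F f (pow F (pow F γ s) i)

      common-divisor≡1 : Injective _≈_ _≈_ P → ∀ {d} → d ∣ r → d ∣ s → d ∣ q-1 → d ≡ 1
      common-divisor≡1 P-injective {d} d∣r d∣s d∣q-1@(divides t q-1≡t*d) = ℕ.*-cancelˡ-≡ d 1 q-1 q-1*d≡q-1*1
        where
        γᵗ-pow≈1 : ∀ {e} → d ∣ e → pow F (pow F γ t) e ≈ 1#
        γᵗ-pow≈1 {e} d∣e = trans (sym (pow-* γ t e))
          (∣⇒pow≈1 (t ℕ.* e) (≡.subst (_∣ t ℕ.* e) (≡.sym q-1≡t*d) (*-monoʳ-∣ t d∣e)))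

        γᵗ≈1 : pow F γ t ≈ 1#
        γᵗ≈1 = P-injective (P-root-of-unity (γᵗ-pow≈1 d∣r) (γᵗ-pow≈1 d∣s))

        t≡q-1 : t ≡ q-1
        t≡q-1 = ∣-antisym (quotient-∣ d∣q-1) (pow≈1⇒∣ t γᵗ≈1)

        q-1*d≡q-1*1 : q-1 ℕ.* d ≡ q-1 ℕ.* 1
        q-1*d≡q-1*1 = ≡.trans (≡.cong (ℕ._* d) (≡.sym t≡q-1)) (≡.trans (≡.sym q-1≡t*d) (≡.sym (ℕ.*-identityʳ q-1)))

      A-≉0 : Injective _≈_ _≈_ P → 1 ≤ r → ∀ i → ¬ A i ≈ 0#
      A-≉0 P-injective 1≤r i Aᵢ≈0 = pow-≉0 i γ≉0 (P-injective (begin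
        P (pow F γ i)                 ≈⟨ P-pow γ i ⟩
        pow F (pow F γ i) r * A i     ≈⟨ *-congˡ Aᵢ≈0 ⟩
        pow F (pow F γ i) r * 0#      ≈⟨ zeroʳ _ ⟩
        0#                            ≈⟨ P-0# 1≤r ⟨
        P 0#                          ∎))

      module _ {l} (q-1≡l*s : q-1 ≡ l ℕ.* s) where
        A-periodic : ∀ i → A (l ℕ.+ i) ≈ A i
        A-periodic i = eval-cong f (begin
          pow F ξ (l ℕ.+ i)       ≈⟨ pow-+ ξ l i ⟩
          pow F ξ l * pow F ξ i   ≈⟨ *-congʳ ξˡ≈1 ⟩
          1# * pow F ξ i          ≈⟨ *-identityˡ _ ⟩
          pow F ξ i               ∎)
          where
          ξ = pow F γ s
          ξˡ≈1 : pow F ξ l ≈ 1#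
          ξˡ≈1 = trans (sym (pow-* γ s l)) (∣⇒pow≈1 (s ℕ.* l) (∣-reflexive (≡.trans q-1≡l*s (ℕ.*-comm l s))))

        prod-units≈prod-unitsʳ*prod-Aˢ : IsPermutation F P → 1 ≤ r →
          prodUpTo F q-1 (pow F γ) ≈ pow F (prodUpTo F q-1 (pow F γ)) r * pow F (prodUpTo F l A) s
        prod-units≈prod-unitsʳ*prod-Aˢ P-permutation 1≤r = begin
          X                                                             ≈⟨ prod-permute-units P-permutation (P-0# 1≤r) ⟨
          prodUpTo F q-1 (λ i → P (pow F γ i))                          ≈⟨ prod-cong q-1 (P-pow γ) ⟩
          prodUpTo F q-1 (λ i → pow F (pow F γ i) r * A i)              ≈⟨ prod-distrib-* q-1 _ A ⟩
          prodUpTo F q-1 (λ i → pow F (pow F γ i) r) * prodUpTo F q-1 A ≈⟨ *-congʳ (prod-pow q-1 (pow F γ) r) ⟩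
          pow F X r * prodUpTo F q-1 A                                  ≡⟨ ≡.cong (λ n → pow F X r * prodUpTo F n A) q-1≡l*s ⟩
          pow F X r * prodUpTo F (l ℕ.* s) A                            ≈⟨ *-congˡ (prod-periodic l A A-periodic s) ⟩
          pow F X r * pow F (prodUpTo F l A) s                          ∎
          where
          X = prodUpTo F q-1 (pow F γ)

        l∣2*index-of-prod-A : .{{_ : NonZero s}} → IsPermutation F P → 1 ≤ r →
                              ∀ b → pow F γ b ≈ prodUpTo F l A → l ∣ 2 ℕ.* b
        l∣2*index-of-prod-A P-permutation 1≤r b γᵇ≈∏A =
          ≡.subst (l ∣_) (ℕ.*-comm b 2) (*-cancelʳ-∣ s (≡.subst (_∣ b ℕ.* 2 ℕ.* s) q-1≡l*s (pow≈1⇒∣ _ γ²ᵇˢ≈1)))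
          where
          γ²ᵇˢ≈1 : pow F γ (b ℕ.* 2 ℕ.* s) ≈ 1#
          γ²ᵇˢ≈1 = begin
            pow F γ (b ℕ.* 2 ℕ.* s)           ≈⟨ pow-* γ (b ℕ.* 2) s ⟩
            pow F (pow F γ (b ℕ.* 2)) s       ≈⟨ pow-cong s (pow-* γ b 2) ⟩
            pow F (pow F (pow F γ b) 2) s     ≈⟨ pow-cong s (pow-cong 2 γᵇ≈∏A) ⟩
            pow F (pow F (prodUpTo F l A) 2) s
              ≈⟨ square-of-pow≈1 r s prod-units-squared (prod-units≈prod-unitsʳ*prod-Aˢ P-permutation 1≤r) ⟩
            1#                                ∎

-- Imported only now, as inside FieldTheory _*_ is the field multiplication.
open import Data.Nat using (_*_)

theorem2p6 : (F : FiniteField) → IsPrimePower (FiniteField.size F) →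
    (l s r : ℕ) → 1 ≤ l → 1 ≤ s → FiniteField.size F ∸ 1 ≡ l * s →
    1 ≤ r → r < FiniteField.size F ∸ 1 →
    (γ : FiniteField.Carrier F) → Primitive F γ →
    (f : Poly F) →
    IsPermutation F (λ x → FiniteField._*_ F (pow F x r) (eval F f (pow F x s))) →
    (gcd r s ≡ 1)
    × ((i : ℕ) → i < l → ¬ (FiniteField._≈_ F (eval F f (pow F (pow F γ s) i)) (FiniteField.0# F)))
    × ((b : ℕ) → FiniteField._≈_ F (pow F γ b) (prodUpTo F l (λ i → eval F f (pow F (pow F γ s) i))) → l ∣ 2 * b)
theorem2p6 F _ l s r _ 1≤s q-1≡l*s 1≤r _ γ γ-primitive f P-permutation@(P-injective , _) =
    common-divisor≡1 γ-primitive P-injective (gcd[m,n]∣m r s) (gcd[m,n]∣n r s) gcd∣q-1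
  , (λ i _ → A-≉0 γ-primitive P-injective 1≤r i)
  , l∣2*index-of-prod-A γ-primitive q-1≡l*s P-permutation 1≤r
  where
  open FieldTheory F using (module PermutationPolynomial)
  open PermutationPolynomial r s f
  instance
    s-nonZero : NonZero s
    s-nonZero = ℕ.>-nonZero 1≤s

  gcd∣q-1 : gcd r s ∣ FiniteField.size F ∸ 1
  gcd∣q-1 = ∣-trans (gcd[m,n]∣n r s) (≡.subst (s ∣_) (≡.sym q-1≡l*s) (n∣m*n l))
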